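{- Let $((A,\to),\mathrm{obs})$ be a QARS. If it satisfies the $\mathrm{obs}$-diamond property (for all $t,s,r\in A$ with $t\to r$ and $t\to s$: $\mathrm{obs}(s)=\mathrm{obs}(r)$, and either $s=r$ or there is $u$ with $r\to u$ and $s\to u$), then it satisfies local $\mathrm{obs}$-RD (for all $t,r,s$ with $t\to r$ and $t\to s$ there exist maximal $\to$-sequences $\langle r_n\rangle$ from $r$ and $\langle s_n\rangle$ from $s$ with $\mathrm{obs}(s_n)=\mathrm{obs}(r_n)$ for all $n$), and local $\mathrm{obs}$-RD implies that for every $t\in A$ the set $\mathrm{Lim}_{\mathrm{obs}}(t)$ contains exactly one element.
   Context: A QARS is an abstract rewrite system $(A,\to)$ together with a map $\mathrm{obs}:A\to S$, where $(S,\le)$ is an $\omega$-complete partial order with least element, such that $t\to s$ implies $\mathrm{obs}(t)\le\mathrm{obs}(s)$. An element is a normal form if it has no $\to$-successor. A maximal $\to$-sequence from $t$ is an infinite sequence $t=t_0,t_1,\dots$ such that for each $i$ either $t_i\to t_{i+1}$, or $t_i=t_{i+1}$ is a normal form. $\mathrm{Lim}_{\mathrm{obs}}(t)$ is the set of all $\sup_n\mathrm{obs}(t_n)$ for $\langle t_n\rangle$ a maximal $\to$-sequence from $t$. -}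

module Defs where

open import Data.Nat using (ℕ; suc)
open import Data.Product using (Σ; ∃; ∃-syntax; _×_)
open import Data.Sum using (_⊎_)
open import Relation.Nullary using (¬_)
open import Relation.Binary.PropositionalEquality using (_≡_)
open import Relation.Binary.Structures using (IsPartialOrder)

IsSup : {S : Set} → (S → S → Set) → (ℕ → S) → S → Set
IsSup _≤_ c x = (∀ n → c n ≤ x) × (∀ y → (∀ n → c n ≤ y) → x ≤ y)

record ωCPO : Set₁ where
  field
    S              : Set
    _≤_            : S → S → Set
    isPartialOrder : IsPartialOrder _≡_ _≤_
    ⊥S             : S
    ⊥S-least       : ∀ x → ⊥S ≤ x
    ωcomplete      : (c : ℕ → S) → (∀ n → c n ≤ c (suc n)) → ∃[ x ] IsSup _≤_ c x

record QARS : Set₁ where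
  field
    A       : Set
    _⟶_     : A → A → Set
    cpo     : ωCPO
  open ωCPO cpo public
  field
    obs      : A → S
    obs-mono : ∀ {t s} → t ⟶ s → obs t ≤ obs s

module _ (Q : QARS) where
  open QARS Q

  NormalForm : A → Set
  NormalForm a = ∀ b → ¬ (a ⟶ b)

  MaximalSeqFrom : A → (ℕ → A) → Set
  MaximalSeqFrom t f =
    (f 0 ≡ t) ×
    (∀ i → (f i ⟶ f (suc i)) ⊎ ((f i ≡ f (suc i)) × NormalForm (f i)))

  InLim : A → S → Set
  InLim t x = ∃[ f ] (MaximalSeqFrom t f × IsSup _≤_ (λ n → obs (f n)) x)

  ObsDiamond : Set
  ObsDiamond = ∀ t s r → t ⟶ r → t ⟶ s →
    (obs s ≡ obs r) × ((s ≡ r) ⊎ (∃[ u ] ((r ⟶ u) × (s ⟶ u))))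

  LocalObsRD : Set
  LocalObsRD = ∀ t r s → t ⟶ r → t ⟶ s →
    ∃[ rs ] ∃[ ss ] (MaximalSeqFrom r rs × MaximalSeqFrom s ss ×
                     (∀ n → obs (ss n) ≡ obs (rs n)))

  LimSingleton : A → Set
  LimSingleton t = ∃[ x ] (InLim t x × (∀ y → InLim t y → y ≡ x))

-- Under local obs-RD, any two maximal sequences from t have the same
-- observation at every index: by induction on the index, apply local obs-RD
-- to their first steps and the induction hypothesis to the tails. Their
-- suprema therefore coincide. Excluded middle is needed only to build some
-- maximal sequence from every element (step if a successor exists, otherwise
-- stay put); this makes Lim_obs(t) inhabited and, prefixed to the joining
-- element u of the diamond, gives the sequences required by local obs-RD.
module Submission where

open import Defs
open import Level using (0ℓ)
open import Axiom.ExcludedMiddle using (ExcludedMiddle)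
open import Data.Nat using (ℕ; zero; suc)
open import Data.Nat.GeneralisedArithmetic using (fold)
open import Data.Product using (Σ; ∃-syntax; _×_; _,_; proj₁; proj₂)
open import Data.Sum using (_⊎_; inj₁; inj₂)
open import Data.Empty using (⊥-elim)
open import Relation.Nullary using (yes; no)
open import Relation.Binary.PropositionalEquality
  using (_≡_; refl; sym; trans; cong; subst)
open import Relation.Binary.Structures using (IsPartialOrder)

IsSup-unique : {S : Set} {_≤_ : S → S → Set} → IsPartialOrder _≡_ _≤_ →
               {c d : ℕ → S} {x y : S} → (∀ n → c n ≡ d n) →
               IsSup _≤_ c x → IsSup _≤_ d y → x ≡ y
IsSup-unique {_≤_ = _≤_} po c≡d (c≤x , x-least) (d≤y , y-least) =
  antisym (x-least _ λ n → subst (_≤ _) (sym (c≡d n)) (d≤y n))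
          (y-least _ λ n → subst (_≤ _) (c≡d n) (c≤x n))
  where open IsPartialOrder po

_◂_ : {A : Set} → A → (ℕ → A) → ℕ → A
(x ◂ f) zero    = x
(x ◂ f) (suc n) = f n

module _ (Q : QARS) where
  open QARS Q

  maximalSeq-firstStep : ∀ {t f} → MaximalSeqFrom Q t f →
                         (t ⟶ f 1) ⊎ ((f 1 ≡ t) × NormalForm Q t)
  maximalSeq-firstStep {f = f} (f0≡t , steps) with steps 0
  ... | inj₁ f0⟶f1        = inj₁ (subst (_⟶ f 1) f0≡t f0⟶f1)
  ... | inj₂ (f0≡f1 , nf) = inj₂ (trans (sym f0≡f1) f0≡t , subst (NormalForm Q) f0≡t nf)

  maximalSeq-tail : ∀ {t f} → MaximalSeqFrom Q t f → MaximalSeqFrom Q (f 1) (λ n → f (suc n))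
  maximalSeq-tail (_ , steps) = refl , λ i → steps (suc i)

  maximalSeq-◂ : ∀ {t u f} → t ⟶ u → MaximalSeqFrom Q u f → MaximalSeqFrom Q t (t ◂ f)
  maximalSeq-◂ {t} t⟶u (f0≡u , steps) = refl , λ
    { zero    → inj₁ (subst (t ⟶_) (sym f0≡u) t⟶u)
    ; (suc i) → steps i
    }

  maximalSeq-obs-mono : ∀ {t f} → MaximalSeqFrom Q t f → ∀ n → obs (f n) ≤ obs (f (suc n))
  maximalSeq-obs-mono (_ , steps) n with steps n
  ... | inj₁ fn⟶fsn     = obs-mono fn⟶fsn
  ... | inj₂ (fn≡fsn , _) = IsPartialOrder.reflexive isPartialOrder (cong obs fn≡fsn)

  module _ (rd : LocalObsRD Q) where

    localObsRD⇒maximalSeq-obs-agree :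
      ∀ n {t f g} → MaximalSeqFrom Q t f → MaximalSeqFrom Q t g → obs (f n) ≡ obs (g n)
    localObsRD⇒maximalSeq-obs-agree zero (f0≡t , _) (g0≡t , _) = cong obs (trans f0≡t (sym g0≡t))
    localObsRD⇒maximalSeq-obs-agree (suc n) {t} {f} {g} mf mg
      with maximalSeq-firstStep mf | maximalSeq-firstStep mg
    ... | inj₁ t⟶f1 | inj₁ t⟶g1 =
      let rs , ss , mrs , mss , obs-ss≡obs-rs = rd t (f 1) (g 1) t⟶f1 t⟶g1 in
      trans (localObsRD⇒maximalSeq-obs-agree n (maximalSeq-tail mf) mrs)
            (trans (sym (obs-ss≡obs-rs n)) (localObsRD⇒maximalSeq-obs-agree n mss (maximalSeq-tail mg)))
    ... | inj₁ t⟶f1 | inj₂ (_ , nf) = ⊥-elim (nf (f 1) t⟶f1)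
    ... | inj₂ (_ , nf) | inj₁ t⟶g1 = ⊥-elim (nf (g 1) t⟶g1)
    ... | inj₂ (f1≡t , _) | inj₂ (g1≡t , _) =
      localObsRD⇒maximalSeq-obs-agree n
        (subst (λ x → MaximalSeqFrom Q x _) f1≡t (maximalSeq-tail mf))
        (subst (λ x → MaximalSeqFrom Q x _) g1≡t (maximalSeq-tail mg))

  module _ (em : ExcludedMiddle 0ℓ) where

    stepOrStay : (t : A) → Σ A λ u → (t ⟶ u) ⊎ ((t ≡ u) × NormalForm Q t)
    stepOrStay t with em {∃[ u ] (t ⟶ u)}
    ... | yes (u , t⟶u) = u , inj₁ t⟶u
    ... | no  irreducible = t , inj₂ (refl , λ u t⟶u → irreducible (u , t⟶u))

    maximalSeq : A → ℕ → A
    maximalSeq t = fold t (λ u → proj₁ (stepOrStay u))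

    maximalSeq-isMaximal : ∀ t → MaximalSeqFrom Q t (maximalSeq t)
    maximalSeq-isMaximal t = refl , λ i → proj₂ (stepOrStay (maximalSeq t i))

    obsDiamond⇒localObsRD : ObsDiamond Q → LocalObsRD Q
    obsDiamond⇒localObsRD diamond t r s t⟶r t⟶s with diamond t s r t⟶r t⟶s
    ... | _ , inj₁ refl =
      maximalSeq r , maximalSeq r , maximalSeq-isMaximal r , maximalSeq-isMaximal r , λ _ → refl
    ... | obs-s≡obs-r , inj₂ (u , r⟶u , s⟶u) =
      r ◂ maximalSeq u , s ◂ maximalSeq u ,
      maximalSeq-◂ r⟶u (maximalSeq-isMaximal u) , maximalSeq-◂ s⟶u (maximalSeq-isMaximal u) ,
      λ { zero → obs-s≡obs-r ; (suc n) → refl }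

    localObsRD⇒limSingleton : LocalObsRD Q → ∀ t → LimSingleton Q t
    localObsRD⇒limSingleton rd t = x , (maximalSeq t , mseq , x-sup) , unique
      where
      mseq : MaximalSeqFrom Q t (maximalSeq t)
      mseq = maximalSeq-isMaximal t

      chainSup : ∃[ x ] IsSup _≤_ (λ n → obs (maximalSeq t n)) x
      chainSup = ωcomplete (λ n → obs (maximalSeq t n)) (maximalSeq-obs-mono mseq)

      x : S
      x = proj₁ chainSup

      x-sup : IsSup _≤_ (λ n → obs (maximalSeq t n)) x
      x-sup = proj₂ chainSup

      unique : ∀ y → InLim Q t y → y ≡ x
      unique y (g , mg , y-sup) =
        IsSup-unique isPartialOrder (λ n → localObsRD⇒maximalSeq-obs-agree rd n mg mseq) y-sup x-sup

mainTheorem11 : ExcludedMiddle 0ℓ → (Q : QARS) →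
    (ObsDiamond Q → LocalObsRD Q) × (LocalObsRD Q → ∀ t → LimSingleton Q t)
mainTheorem11 em Q = obsDiamond⇒localObsRD Q em , localObsRD⇒limSingleton Q em
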